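{- Let $\varepsilon>0$ with $1/\varepsilon\in\mathbb{Z}_{\ge 2}$ and let $I_1$ be an instance of scheduling with setup times on uniformly related machines in which all job sizes and setup sizes are positive. Form the instance $I_2$ from $I_1$ as follows: for each class $k$, let $\mathcal{J}'_k=\{j: k_j=k,\ p_j\le\varepsilon s_k\}$; remove the jobs of $\mathcal{J}'_k$ and add $\lceil(\sum_{j\in\mathcal{J}'_k}p_j)/(\varepsilon s_k)\rceil$ new jobs of class $k$, each of size $\varepsilon s_k$. Then: if $I_1$ has a schedule with makespan at most $T'$, then $I_2$ has a schedule with makespan at most $(1+\varepsilon)T'$; and if $I_2$ has a schedule with makespan at most $T'$, then $I_1$ has a schedule with makespan at most $(1+\varepsilon)T'$.
   Context: In an instance, there is a set $\mathcal{J}$ of jobs, a set $\mathcal{M}$ of machines and a set $\mathcal{K}$ of classes; each job $j$ belongs to one class $k_j$. Each machine $i$ has a speed $v_i>0$, each job $j$ a size $p_j$, each class $k$ a setup size $s_k$; processing time of $j$ on $i$ is $p_j/v_i$ and setup time of $k$ on $i$ is $s_k/v_i$. A schedule is a map $\sigma:\mathcal{J}\to\mathcal{M}$; the load of machine $i$ is $\sum_{j\in\sigma^{ -1}(i)}p_j/v_i+\sum_{k\in\{k_j:j\in\sigma^{ -1}(i)\}}s_k/v_i$ and the makespan is the maximum load.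
   Formalization: The machine speeds, job sizes, setup sizes and the makespan bound $T'$ are rational. -}

module Defs where

open import Data.Nat using (ℕ; zero; suc)
open import Data.Fin using (Fin; zero; suc)
open import Data.Fin.Properties using (any?) renaming (_≟_ to _≟ᶠ_)
open import Data.Integer using (ℤ; ∣_∣)
open import Data.Rational using (ℚ; 0ℚ; _+_; _*_; _÷_; _≤_; _<_; ≢-nonZero; ceiling)
open import Data.Rational.Properties using (_≤?_) renaming (_≟_ to _≟ℚ_)
open import Data.List using (List; []; _∷_; length; filter; replicate; concatMap; foldr; map; lookup)
open import Data.List.Relation.Unary.All using (All)
open import Data.List.Relation.Unary.Any using ()
open import Data.Product using (_×_; _,_; proj₁; proj₂; ∃)
open import Data.Bool using (if_then_else_)
open import Relation.Nullary using (yes; no; ¬?; does)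
open import Relation.Nullary.Decidable using (_×-dec_)
open import Relation.Binary.PropositionalEquality using (_≡_)
import Data.Fin as F

-- Division on ℚ, total: junk value 0 when dividing by 0
-- (never used under the theorem's positivity hypotheses).
_/?_ : ℚ → ℚ → ℚ
p /? q with q ≟ℚ 0ℚ
... | yes _ = 0ℚ
... | no q≢0 = _÷_ p q {{≢-nonZero q≢0}}

sumFin : (n : ℕ) → (Fin n → ℚ) → ℚ
sumFin zero    f = 0ℚ
sumFin (suc n) f = f zero + sumFin n (λ i → f (suc i))

record Instance : Set where
  field
    m     : ℕ
    c     : ℕ
    speed : Fin m → ℚ
    setup : Fin c → ℚ
    jobs  : List (Fin c × ℚ)

open Instance public

Job : Instance → Set
Job I = Fin (length (jobs I))

jobClass : (I : Instance) → Job I → Fin (c I)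
jobClass I j = proj₁ (lookup (jobs I) j)

jobSize : (I : Instance) → Job I → ℚ
jobSize I j = proj₂ (lookup (jobs I) j)

Schedule : Instance → Set
Schedule I = Job I → Fin (m I)

load : (I : Instance) → Schedule I → Fin (m I) → ℚ
load I σ i =
  (sumFin (length (jobs I)) (λ j → if does (σ j ≟ᶠ i) then jobSize I j else 0ℚ)
   + sumFin (c I) (λ k → if does (any? (λ j → (σ j ≟ᶠ i) ×-dec (jobClass I j ≟ᶠ k)))
                          then setup I k else 0ℚ))
  /? speed I i

MakespanAtMost : (I : Instance) → Schedule I → ℚ → Set
MakespanAtMost I σ T = ∀ i → load I σ i ≤ T

PositiveInstance : Instance → Set
PositiveInstance I =
  (∀ i → 0ℚ < speed I i) × (∀ k → 0ℚ < setup I k) × (∀ j → 0ℚ < jobSize I j)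

small? : (I : Instance) (ε : ℚ) (x : Fin (c I) × ℚ) → _
small? I ε (k , p) = p ≤? (ε * setup I k)

smallTotal : (I : Instance) → ℚ → Fin (c I) → ℚ
smallTotal I ε k =
  foldr _+_ 0ℚ (map proj₂ (filter (λ x → (proj₁ x ≟ᶠ k) ×-dec small? I ε x) (jobs I)))

newCount : (I : Instance) → ℚ → Fin (c I) → ℕ
newCount I ε k = ∣ ceiling (smallTotal I ε k /? (ε * setup I k)) ∣

I₂ : Instance → ℚ → Instance
I₂ I ε = record
  { m = m I ; c = c I ; speed = speed I ; setup = setup I
  ; jobs = filter (λ x → ¬? (small? I ε x)) (jobs I)
           Data.List.++ concatMap (λ k → replicate (newCount I ε k) (k , ε * setup I k))
                                  (Data.List.allFin (c I))
  }
  where import Data.List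

-- Write δ k = ε s_k. From a schedule of I₁, replace on each machine i the small jobs of
-- class k, of total size X_ik, by up to ⌈X_ik / δ k⌉ new jobs of size δ k; the quotas
-- ⌈X_ik / δ k⌉ add up to at least ⌈Σ_i X_ik / δ k⌉, the number of new jobs of I₂.
-- Conversely, from a schedule of I₂ lay the new class-k jobs of all machines end to end on
-- a line and pour the small class-k jobs of I₁ onto it in order, each one going to the
-- machine whose segment contains its starting point; since it has size at most δ k, a
-- machine receives at most its segment plus δ k. Either way a machine runs only classes it
-- ran before, each with at most ε s_k more work, which its setup s_k pays for: every load
-- grows by a factor at most 1 + ε.

module Submission where

open import Defs

-- A separate module, so that the rational _≤_ it opens does not clash with the
-- natural-number _≤_ of the statement below.
module SmallJobRounding where
  open import Data.Nat as ℕ using (ℕ; zero; suc)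
  import Data.Nat.Properties as ℕP
  open import Data.Integer as ℤ using (ℤ; ∣_∣)
  import Data.Integer.Properties as ℤP
  import Data.Integer.DivMod as ℤD
  open import Data.Integer.Tactic.RingSolver using (solve-∀)
  open import Data.Nat.Coprimality using (Coprime)
  open import Data.Rational as Q
    using (ℚ; mkℚ; 0ℚ; 1ℚ; _+_; _*_; _-_; -_; _⊔_; ↥_; ↧_; ↧ₙ_; ceiling; floor; _÷_; 1/_; _≤_; _<_)
  open import Data.Rational.Literals using (fromℤ)
  import Data.Rational.Properties as QP
  import Data.Rational.Unnormalised as U
  import Data.Rational.Unnormalised.Properties as UP
  import Data.Rational.Solver as QS
  open import Algebra.Bundles using (CommutativeMonoid)
  open import Algebra.Properties.CommutativeSemigroup (CommutativeMonoid.commutativeSemigroup QP.+-0-commutativeMonoid)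
    using (interchange; x∙yz≈y∙xz; xy∙z≈z∙xy)
  open import Data.Fin as F using (Fin)
  open import Data.Fin.Properties using (suc-injective; any?) renaming (_≟_ to _≟ᶠ_)
  open import Data.Bool using (if_then_else_)
  open import Data.List
    using (List; []; _∷_; _++_; map; filter; tabulate; lookup; replicate; concatMap; allFin; take; length; foldr)
  import Data.List.Properties as LP
  open import Data.List.Relation.Unary.Any as Any using (Any; here; there)
  import Data.List.Relation.Unary.Any.Properties as AnyP
  open import Data.List.Relation.Unary.All as All using (All; []; _∷_)
  import Data.List.Relation.Unary.All.Properties as AllP
  open import Data.List.Relation.Ternary.Interleaving using ([]; _∷ˡ_; _∷ʳ_)
  open import Data.List.Relation.Ternary.Interleaving.Propositional using (Interleaving)
  open import Data.Product using (_×_; _,_; proj₁; proj₂; ∃)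
  open import Data.Sum using (_⊎_; inj₁; inj₂; [_,_]′; map₁; map₂)
  open import Data.Empty using (⊥-elim)
  open import Function using (_∘_; id)
  open import Relation.Nullary using (Dec; yes; no; does; ¬_; ¬?)
  open import Relation.Nullary.Decidable using (_×-dec_)
  open import Relation.Binary.PropositionalEquality

  fromℤ-+ : ∀ a b → fromℤ (a ℤ.+ b) ≡ fromℤ a + fromℤ b
  fromℤ-+ a b = QP.toℚᵘ-injective (UP.≃-trans (U.*≡* eq) (UP.≃-sym (QP.toℚᵘ-homo-+ (fromℤ a) (fromℤ b))))
    where
    eq : (a ℤ.+ b) ℤ.* ℤ.+ 1 ≡ (a ℤ.* ℤ.+ 1 ℤ.+ b ℤ.* ℤ.+ 1) ℤ.* ℤ.+ 1
    eq = cong (ℤ._* ℤ.+ 1) (sym (cong₂ ℤ._+_ (ℤP.*-identityʳ a) (ℤP.*-identityʳ b)))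

  floor-neg : ∀ a b .(c : Coprime ∣ a ∣ (suc b)) → floor (- mkℚ a b c) ≡ (ℤ.- a) ℤ./ ℤ.+ suc b
  floor-neg (ℤ.+ 0)     b c = refl
  floor-neg ℤ.+[1+ n ]  b c = refl
  floor-neg ℤ.-[1+ n ]  b c = refl

  ceiling-*-↧ : ∀ x → ∃ λ r → r ℕ.< ↧ₙ x × ceiling x ℤ.* ↧ x ≡ ↥ x ℤ.+ ℤ.+ r
  ceiling-*-↧ x@(mkℚ a b c) = r , ℤD.n%d<d (ℤ.- a) D , (begin
      ceiling x ℤ.* D                       ≡⟨ cong (λ q → ℤ.- q ℤ.* D) (floor-neg a b c) ⟩
      ℤ.- q ℤ.* D                           ≡⟨ rearrange q (ℤ.+ r) D ⟩
      ℤ.- (ℤ.+ r ℤ.+ q ℤ.* D) ℤ.+ ℤ.+ r     ≡⟨ cong (λ w → ℤ.- w ℤ.+ ℤ.+ r) (sym (ℤD.a≡a%n+[a/n]*n (ℤ.- a) D)) ⟩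
      ℤ.- (ℤ.- a) ℤ.+ ℤ.+ r                 ≡⟨ cong (ℤ._+ ℤ.+ r) (ℤP.neg-involutive a) ⟩
      a ℤ.+ ℤ.+ r                           ∎)
    where
    open ≡-Reasoning
    D = ℤ.+ suc b
    q = (ℤ.- a) ℤ./ D
    r = (ℤ.- a) ℤD.% D
    rearrange : ∀ q r D → ℤ.- q ℤ.* D ≡ ℤ.- (r ℤ.+ q ℤ.* D) ℤ.+ r
    rearrange = solve-∀

  ceiling-bounds : ∀ x → x ≤ fromℤ (ceiling x) × fromℤ (ceiling x) < x + 1ℚ
  ceiling-bounds x@(mkℚ a b c) with ceiling-*-↧ x
  ... | r , r<D , zD≡a+r = lower , subst (_< x + 1ℚ) (sym z≡z-1+1) (QP.+-monoˡ-< 1ℚ below)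
    where
    z = ceiling x
    D = ℤ.+ suc b
    lower : x ≤ fromℤ z
    lower = Q.*≤* (begin
      a ℤ.* ℤ.+ 1    ≡⟨ ℤP.*-identityʳ a ⟩
      a              ≤⟨ ℤP.i≤i+j a (ℤ.+ r) ⟩
      a ℤ.+ ℤ.+ r    ≡⟨ zD≡a+r ⟨
      z ℤ.* D        ∎)
      where open ℤP.≤-Reasoning
    below : fromℤ (z ℤ.- ℤ.+ 1) < x
    below = Q.*<* (begin-strict
      (z ℤ.- ℤ.+ 1) ℤ.* D        ≡⟨ ℤP.*-distribʳ-+ D z (ℤ.- ℤ.+ 1) ⟩
      z ℤ.* D ℤ.- ℤ.+ 1 ℤ.* D    ≡⟨ cong₂ ℤ._-_ zD≡a+r (ℤP.*-identityˡ D) ⟩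
      a ℤ.+ ℤ.+ r ℤ.- D          ≡⟨ ℤP.+-assoc a (ℤ.+ r) (ℤ.- D) ⟩
      a ℤ.+ (ℤ.+ r ℤ.- D)        <⟨ ℤP.+-monoʳ-< a r-D<0 ⟩
      a ℤ.+ ℤ.+ 0                ≡⟨ ℤP.+-identityʳ a ⟩
      a                          ≡⟨ ℤP.*-identityʳ a ⟨
      a ℤ.* ℤ.+ 1                ∎)
      where
      open ℤP.≤-Reasoning
      r-D<0 : ℤ.+ r ℤ.- D ℤ.< ℤ.+ 0
      r-D<0 = subst (ℤ.+ r ℤ.- D ℤ.<_) (ℤP.+-inverseʳ D) (ℤP.+-monoˡ-< (ℤ.- D) (ℤ.+<+ r<D))
    sub-add : ∀ z → z ≡ z ℤ.- ℤ.+ 1 ℤ.+ ℤ.+ 1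
    sub-add = solve-∀
    z≡z-1+1 : fromℤ z ≡ fromℤ (z ℤ.- ℤ.+ 1) + 1ℚ
    z≡z-1+1 = trans (cong fromℤ (sub-add z)) (fromℤ-+ (z ℤ.- ℤ.+ 1) (ℤ.+ 1))

  *-monoʳ-≤-0≤ : ∀ {p q} r → 0ℚ ≤ r → p ≤ q → p * r ≤ q * r
  *-monoʳ-≤-0≤ r 0≤r = QP.*-monoʳ-≤-nonNeg r {{Q.nonNegative 0≤r}}

  *-monoʳ-<-0< : ∀ {p q} r → 0ℚ < r → p < q → p * r < q * r
  *-monoʳ-<-0< r 0<r = QP.*-monoˡ-<-pos r {{Q.positive 0<r}}

  0≤* : ∀ {p q} → 0ℚ ≤ p → 0ℚ ≤ q → 0ℚ ≤ p * q
  0≤* {p} {q} 0≤p 0≤q = subst (_≤ p * q) (QP.*-zeroˡ q) (*-monoʳ-≤-0≤ q 0≤q 0≤p)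

  0<* : ∀ {p q} → 0ℚ < p → 0ℚ < q → 0ℚ < p * q
  0<* {p} {q} 0<p 0<q = subst (_< p * q) (QP.*-zeroˡ q) (*-monoʳ-<-0< q 0<q 0<p)

  p≤p+q : ∀ p {q} → 0ℚ ≤ q → p ≤ p + q
  p≤p+q p {q} 0≤q = subst (_≤ p + q) (QP.+-identityʳ p) (QP.+-monoʳ-≤ p 0≤q)

  p≤q⇒0≤q-p : ∀ {p q} → p ≤ q → 0ℚ ≤ q - p
  p≤q⇒0≤q-p {p} {q} p≤q = subst (_≤ q - p) (QP.+-inverseʳ p) (QP.+-monoˡ-≤ (- p) p≤q)

  0≤1+p : ∀ {p} → 0ℚ ≤ p → 0ℚ ≤ 1ℚ + p
  0≤1+p 0≤p = QP.≤-trans (QP.<⇒≤ (QP.positive⁻¹ 1ℚ)) (p≤p+q 1ℚ 0≤p)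

  0<⇒≢0 : ∀ {p} → 0ℚ < p → p ≢ 0ℚ
  0<⇒≢0 0<p p≡0 = QP.<-irrefl (sym p≡0) 0<p

  /?≡÷ : ∀ p q (q≢0 : q ≢ 0ℚ) → p /? q ≡ (p ÷ q) {{Q.≢-nonZero q≢0}}
  /?≡÷ p q q≢0 with q QP.≟ 0ℚ
  ... | yes q≡0 = ⊥-elim (q≢0 q≡0)
  ... | no _    = refl

  /?-*-cancel : ∀ p {q} → q ≢ 0ℚ → (p /? q) * q ≡ p
  /?-*-cancel p {q} q≢0 = begin
    (p /? q) * q      ≡⟨ cong (_* q) (/?≡÷ p q q≢0) ⟩
    p * (1/ q) * q    ≡⟨ QP.*-assoc p _ q ⟩
    p * ((1/ q) * q)  ≡⟨ cong (p *_) (QP.*-inverseˡ q) ⟩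
    p * 1ℚ            ≡⟨ QP.*-identityʳ p ⟩
    p                 ∎
    where
    open ≡-Reasoning
    instance _ = Q.≢-nonZero q≢0

  /?-≤ : ∀ a T {v} → 0ℚ < v → a ≤ T * v → a /? v ≤ T
  /?-≤ a T {v} 0<v a≤Tv =
    QP.*-cancelʳ-≤-pos v {{Q.positive 0<v}} (subst (_≤ T * v) (sym (/?-*-cancel a (0<⇒≢0 0<v))) a≤Tv)

  /?-≤⁻ : ∀ a T {v} → 0ℚ < v → a /? v ≤ T → a ≤ T * v
  /?-≤⁻ a T {v} 0<v a/v≤T = subst (_≤ T * v) (/?-*-cancel a (0<⇒≢0 0<v)) (*-monoʳ-≤-0≤ v (QP.<⇒≤ 0<v) a/v≤T)

  infixr 8 _·_

  _·_ : ℕ → ℚ → ℚ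
  zero  · d = 0ℚ
  suc n · d = d + n · d

  ·-distribʳ-+ : ∀ a b d → (a ℕ.+ b) · d ≡ a · d + b · d
  ·-distribʳ-+ zero    b d = sym (QP.+-identityˡ _)
  ·-distribʳ-+ (suc a) b d = trans (cong (λ w → d + w) (·-distribʳ-+ a b d)) (sym (QP.+-assoc d _ _))

  ·-nonNeg : ∀ n {d} → 0ℚ ≤ d → 0ℚ ≤ n · d
  ·-nonNeg zero    0≤d = QP.≤-refl
  ·-nonNeg (suc n) 0≤d = QP.+-mono-≤ 0≤d (·-nonNeg n 0≤d)

  ·-monoˡ-≤ : ∀ {a b} d → 0ℚ ≤ d → a ℕ.≤ b → a · d ≤ b · d
  ·-monoˡ-≤ {zero}  {b} d 0≤d _ = ·-nonNeg b 0≤d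
  ·-monoˡ-≤ {suc a} {suc b} d 0≤d (ℕ.s≤s a≤b) = QP.+-monoʳ-≤ d (·-monoˡ-≤ d 0≤d a≤b)

  ·≡fromℤ* : ∀ n d → n · d ≡ fromℤ (ℤ.+ n) * d
  ·≡fromℤ* zero    d = sym (QP.*-zeroˡ d)
  ·≡fromℤ* (suc n) d = begin
    d + n · d                       ≡⟨ cong₂ _+_ (sym (QP.*-identityˡ d)) (·≡fromℤ* n d) ⟩
    1ℚ * d + fromℤ (ℤ.+ n) * d      ≡⟨ QP.*-distribʳ-+ d 1ℚ (fromℤ (ℤ.+ n)) ⟨
    (1ℚ + fromℤ (ℤ.+ n)) * d        ≡⟨ cong (_* d) (fromℤ-+ (ℤ.+ 1) (ℤ.+ n)) ⟨
    fromℤ (ℤ.+ suc n) * d           ∎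
    where open ≡-Reasoning

  -- ⌈P / δ⌉ in ℕ, written exactly as newCount writes it.
  ceilCount : ℚ → ℚ → ℕ
  ceilCount P δ = ∣ ceiling (P /? δ) ∣

  ceilCount-bounds : ∀ P {δ} → 0ℚ < δ → 0ℚ ≤ P → P ≤ ceilCount P δ · δ × ceilCount P δ · δ < P + δ
  ceilCount-bounds P {δ} 0<δ 0≤P = subst (P ≤_) (sym n·δ≡zδ) P≤zδ , subst (_< P + δ) (sym n·δ≡zδ) zδ<P+δ
    where
    x = P /? δ
    z = ceiling x
    xδ≡P : x * δ ≡ P
    xδ≡P = /?-*-cancel P (0<⇒≢0 0<δ)
    0≤x : 0ℚ ≤ x
    0≤x = QP.≮⇒≥ λ x<0 →
      QP.<-irrefl refl (QP.<-≤-trans (subst₂ _<_ xδ≡P (QP.*-zeroˡ δ) (*-monoʳ-<-0< δ 0<δ x<0)) 0≤P)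
    bounds = ceiling-bounds x
    0≤z : ℤ.+ 0 ℤ.≤ z
    0≤z with QP.≤-trans 0≤x (proj₁ bounds)
    ... | Q.*≤* 0≤z*1 = subst (ℤ.+ 0 ℤ.≤_) (ℤP.*-identityʳ z) 0≤z*1
    n·δ≡zδ : ∣ z ∣ · δ ≡ fromℤ z * δ
    n·δ≡zδ = trans (·≡fromℤ* ∣ z ∣ δ) (cong (λ w → fromℤ w * δ) (ℤP.0≤i⇒+∣i∣≡i 0≤z))
    P≤zδ : P ≤ fromℤ z * δ
    P≤zδ = subst (_≤ fromℤ z * δ) xδ≡P (*-monoʳ-≤-0≤ δ (QP.<⇒≤ 0<δ) (proj₁ bounds))
    zδ<P+δ : fromℤ z * δ < P + δ
    zδ<P+δ = subst (fromℤ z * δ <_) (trans (QP.*-distribʳ-+ δ x 1ℚ) (cong₂ _+_ xδ≡P (QP.*-identityˡ δ)))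
               (*-monoʳ-<-0< δ 0<δ (proj₂ bounds))

  ceilCount-0 : ∀ δ → ceilCount 0ℚ δ ≡ 0
  ceilCount-0 δ with δ QP.≟ 0ℚ
  ... | yes _   = refl
  ... | no δ≢0 = cong (λ w → ∣ ceiling w ∣) (QP.*-zeroˡ ((1/ δ) {{Q.≢-nonZero δ≢0}}))

  ·-cancelʳ-< : ∀ a b {d} → 0ℚ ≤ d → a · d < b · d → a ℕ.< b
  ·-cancelʳ-< a b {d} 0≤d ad<bd with a ℕ.<? b
  ... | yes a<b = a<b
  ... | no a≮b  = ⊥-elim (QP.<-irrefl refl (QP.<-≤-trans ad<bd (·-monoˡ-≤ d 0≤d (ℕP.≮⇒≥ a≮b))))

  select : ∀ {p} {P : Set p} → Dec P → ℚ → ℚ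
  select P? x = if does P? then x else 0ℚ

  module _ {p} {P : Set p} where

    select-yes : (P? : Dec P) → P → ∀ x → select P? x ≡ x
    select-yes (yes _) _  x = refl
    select-yes (no ¬p) p x = ⊥-elim (¬p p)

    select-no : (P? : Dec P) → ¬ P → ∀ x → select P? x ≡ 0ℚ
    select-no (yes p) ¬p x = ⊥-elim (¬p p)
    select-no (no _)  _  x = refl

    select-nonNeg : (P? : Dec P) → ∀ {x} → 0ℚ ≤ x → 0ℚ ≤ select P? x
    select-nonNeg (yes _) 0≤x = 0≤x
    select-nonNeg (no _)  _   = QP.≤-refl

  select-0 : ∀ {p} {P : Set p} (P? : Dec P) → select P? 0ℚ ≡ 0ℚ
  select-0 (yes _) = refl
  select-0 (no _)  = refl

  select-+ : ∀ {p} {P : Set p} (P? : Dec P) x y → select P? (x + y) ≡ select P? x + select P? y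
  select-+ (yes _) x y = refl
  select-+ (no _)  x y = refl

  select-cong : ∀ {p q} {P : Set p} {Q : Set q} (P? : Dec P) (Q? : Dec Q) → (P → Q) → (Q → P) →
                ∀ x → select P? x ≡ select Q? x
  select-cong (yes _) (yes _) _   _   x = refl
  select-cong (no _)  (no _)  _   _   x = refl
  select-cong (yes p) (no ¬q) p⇒q _   x = ⊥-elim (¬q (p⇒q p))
  select-cong (no ¬p) (yes q) _   q⇒p x = ⊥-elim (¬p (q⇒p q))

  sumFin-+ : ∀ n (f g : Fin n → ℚ) → sumFin n (λ j → f j + g j) ≡ sumFin n f + sumFin n g
  sumFin-+ zero    f g = refl
  sumFin-+ (suc n) f g = trans (cong (f F.zero + g F.zero +_) (sumFin-+ n (λ j → f (F.suc j)) (λ j → g (F.suc j))))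
    (interchange (f F.zero) (g F.zero) (sumFin n (λ j → f (F.suc j))) (sumFin n (λ j → g (F.suc j))))

  sumFin-*ˡ : ∀ n a (f : Fin n → ℚ) → sumFin n (λ j → a * f j) ≡ a * sumFin n f
  sumFin-*ˡ zero    a f = sym (QP.*-zeroʳ a)
  sumFin-*ˡ (suc n) a f = trans (cong (a * f F.zero +_) (sumFin-*ˡ n a (λ j → f (F.suc j)))) (sym (QP.*-distribˡ-+ a _ _))

  sumFin-mono-≤ : ∀ n {f g : Fin n → ℚ} → (∀ j → f j ≤ g j) → sumFin n f ≤ sumFin n g
  sumFin-mono-≤ zero    f≤g = QP.≤-refl
  sumFin-mono-≤ (suc n) f≤g = QP.+-mono-≤ (f≤g F.zero) (sumFin-mono-≤ n (λ j → f≤g (F.suc j)))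

  sumFin-cong : ∀ n {f g : Fin n → ℚ} → (∀ j → f j ≡ g j) → sumFin n f ≡ sumFin n g
  sumFin-cong zero    f≡g = refl
  sumFin-cong (suc n) f≡g = cong₂ _+_ (f≡g F.zero) (sumFin-cong n (f≡g ∘ F.suc))

  sumFin-0 : ∀ n {f : Fin n → ℚ} → (∀ j → f j ≡ 0ℚ) → sumFin n f ≡ 0ℚ
  sumFin-0 zero    f≡0 = refl
  sumFin-0 (suc n) f≡0 = cong₂ _+_ (f≡0 F.zero) (sumFin-0 n (λ j → f≡0 (F.suc j)))

  sumFin-single : ∀ n (j₀ : Fin n) {f : Fin n → ℚ} → (∀ j → j ≢ j₀ → f j ≡ 0ℚ) → sumFin n f ≡ f j₀
  sumFin-single (suc n) F.zero      {f} f≡0 =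
    trans (cong (f F.zero +_) (sumFin-0 n (λ j → f≡0 (F.suc j) (λ ())))) (QP.+-identityʳ _)
  sumFin-single (suc n) (F.suc j₀) {f} f≡0 =
    trans (cong₂ _+_ (f≡0 F.zero (λ ())) (sumFin-single n j₀ (λ j j≢j₀ → f≡0 (F.suc j) (j≢j₀ ∘ suc-injective))))
          (QP.+-identityˡ _)

  sumFin-selectʳ : ∀ n (j₀ : Fin n) (x : ℚ) → sumFin n (λ j → select (j₀ ≟ᶠ j) x) ≡ x
  sumFin-selectʳ n j₀ x =
    trans (sumFin-single n j₀ (λ j j≢j₀ → select-no (j₀ ≟ᶠ j) (j≢j₀ ∘ sym) x)) (select-yes (j₀ ≟ᶠ j₀) refl x)

  sumFin-selectˡ : ∀ n (j₀ : Fin n) (f : Fin n → ℚ) → sumFin n (λ j → select (j ≟ᶠ j₀) (f j)) ≡ f j₀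
  sumFin-selectˡ n j₀ f =
    trans (sumFin-single n j₀ (λ j j≢j₀ → select-no (j ≟ᶠ j₀) j≢j₀ (f j))) (select-yes (j₀ ≟ᶠ j₀) refl (f j₀))

  multiplicity : ∀ {n} → Fin n → List (Fin n) → ℕ
  multiplicity i []       = 0
  multiplicity i (i′ ∷ l) = if does (i′ ≟ᶠ i) then suc (multiplicity i l) else multiplicity i l

  multiplicity-++ : ∀ {n} (i : Fin n) l l′ → multiplicity i (l ++ l′) ≡ multiplicity i l ℕ.+ multiplicity i l′
  multiplicity-++ i []       l′ = refl
  multiplicity-++ i (i′ ∷ l) l′ with i′ ≟ᶠ i
  ... | yes _ = cong suc (multiplicity-++ i l l′)
  ... | no _  = multiplicity-++ i l l′

  multiplicity-replicate : ∀ {n} (i j : Fin n) r → multiplicity i (replicate r j) ≡ (if does (j ≟ᶠ i) then r else 0)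
  multiplicity-replicate i j zero    with j ≟ᶠ i
  ... | yes _ = refl
  ... | no _  = refl
  multiplicity-replicate i j (suc r) with j ≟ᶠ i | multiplicity-replicate i j r
  ... | yes _ | ih = cong suc ih
  ... | no _  | ih = ih

  multiplicity-map-suc : ∀ {n} (i : Fin n) l → multiplicity (F.suc i) (map F.suc l) ≡ multiplicity i l
  multiplicity-map-suc i []       = refl
  multiplicity-map-suc i (i′ ∷ l) with i′ ≟ᶠ i
  ... | yes _ = cong suc (multiplicity-map-suc i l)
  ... | no _  = multiplicity-map-suc i l

  multiplicity-map-suc-zero : ∀ {n} (l : List (Fin n)) → multiplicity F.zero (map F.suc l) ≡ 0
  multiplicity-map-suc-zero []      = refl
  multiplicity-map-suc-zero (_ ∷ l) = multiplicity-map-suc-zero l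

  multiplicity-take : ∀ {n} (i : Fin n) r l → multiplicity i (take r l) ℕ.≤ multiplicity i l
  multiplicity-take i zero    l        = ℕ.z≤n
  multiplicity-take i (suc r) []       = ℕ.z≤n
  multiplicity-take i (suc r) (i′ ∷ l) with i′ ≟ᶠ i
  ... | yes _ = ℕ.s≤s (multiplicity-take i r l)
  ... | no _  = multiplicity-take i r l

  withMultiplicities : ∀ n → (Fin n → ℕ) → List (Fin n)
  withMultiplicities zero    f = []
  withMultiplicities (suc n) f = replicate (f F.zero) F.zero ++ map F.suc (withMultiplicities n (f ∘ F.suc))

  multiplicity-withMultiplicities : ∀ n f (i : Fin n) → multiplicity i (withMultiplicities n f) ≡ f i
  multiplicity-withMultiplicities (suc n) f F.zero = begin
    multiplicity F.zero (replicate (f F.zero) F.zero ++ map F.suc rest)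
      ≡⟨ multiplicity-++ F.zero (replicate (f F.zero) F.zero) _ ⟩
    multiplicity F.zero (replicate (f F.zero) F.zero) ℕ.+ multiplicity F.zero (map F.suc rest)
      ≡⟨ cong₂ ℕ._+_ (multiplicity-replicate F.zero F.zero (f F.zero)) (multiplicity-map-suc-zero rest) ⟩
    f F.zero ℕ.+ 0
      ≡⟨ ℕP.+-identityʳ (f F.zero) ⟩
    f F.zero ∎
    where
    open ≡-Reasoning
    rest = withMultiplicities n (f ∘ F.suc)
  multiplicity-withMultiplicities (suc n) f (F.suc i) = begin
    multiplicity (F.suc i) (replicate (f F.zero) F.zero ++ map F.suc rest)
      ≡⟨ multiplicity-++ (F.suc i) (replicate (f F.zero) F.zero) _ ⟩
    multiplicity (F.suc i) (replicate (f F.zero) F.zero) ℕ.+ multiplicity (F.suc i) (map F.suc rest)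
      ≡⟨ cong₂ ℕ._+_ (multiplicity-replicate (F.suc i) F.zero (f F.zero)) (multiplicity-map-suc i rest) ⟩
    multiplicity i rest
      ≡⟨ multiplicity-withMultiplicities n (f ∘ F.suc) i ⟩
    f (F.suc i) ∎
    where
    open ≡-Reasoning
    rest = withMultiplicities n (f ∘ F.suc)

  length-withMultiplicities-· : ∀ n f d → length (withMultiplicities n f) · d ≡ sumFin n (λ i → f i · d)
  length-withMultiplicities-· zero    f d = refl
  length-withMultiplicities-· (suc n) f d = begin
    length (replicate (f F.zero) F.zero ++ map F.suc rest) · d
      ≡⟨ cong (_· d) (LP.length-++ (replicate (f F.zero) F.zero)) ⟩
    (length (replicate (f F.zero) F.zero) ℕ.+ length (map F.suc rest)) · d
      ≡⟨ cong₂ (λ a b → (a ℕ.+ b) · d) (LP.length-replicate (f F.zero)) (LP.length-map F.suc rest) ⟩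
    (f F.zero ℕ.+ length rest) · d
      ≡⟨ ·-distribʳ-+ (f F.zero) (length rest) d ⟩
    f F.zero · d + length rest · d
      ≡⟨ cong (f F.zero · d +_) (length-withMultiplicities-· n (f ∘ F.suc) d) ⟩
    sumFin (suc n) (λ i → f i · d) ∎
    where
    open ≡-Reasoning
    rest = withMultiplicities n (f ∘ F.suc)

  -- Segments of a line

  offset : ∀ n → (Fin n → ℚ) → Fin n → ℚ
  offset (suc n) cap F.zero    = 0ℚ
  offset (suc n) cap (F.suc i) = cap F.zero + offset n (cap ∘ F.suc) i

  offset-nonNeg : ∀ n {cap} → (∀ j → 0ℚ ≤ cap j) → ∀ i → 0ℚ ≤ offset n cap i
  offset-nonNeg (suc n) 0≤cap F.zero    = QP.≤-refl
  offset-nonNeg (suc n) 0≤cap (F.suc i) = QP.+-mono-≤ (0≤cap F.zero) (offset-nonNeg n (0≤cap ∘ F.suc) i)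

  private
    open QS.+-*-Solver
    add-sub : ∀ x y → y + (x - y) ≡ x
    add-sub = solve 2 (λ x y → y :+ (x :- y) := x) refl
    sub-add : ∀ x y → x + y - x ≡ y
    sub-add = solve 2 (λ x y → x :+ y :- x := y) refl

  interval-containing : ∀ n cap {s} → 0ℚ ≤ s → s < sumFin n cap →
    ∃ λ i → offset n cap i ≤ s × s < offset n cap i + cap i
  interval-containing zero    cap 0≤s s<0 = ⊥-elim (QP.<-irrefl refl (QP.≤-<-trans 0≤s s<0))
  interval-containing (suc n) cap {s} 0≤s s<sum with s QP.<? cap F.zero
  ... | yes s<cap₀ = F.zero , 0≤s , subst (s <_) (sym (QP.+-identityˡ _)) s<cap₀
  ... | no s≮cap₀ with interval-containing n (cap ∘ F.suc) (p≤q⇒0≤q-p (QP.≮⇒≥ s≮cap₀))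
                         (subst (s - cap F.zero <_) (sub-add (cap F.zero) _) (QP.+-monoˡ-< (- cap F.zero) s<sum))
  ...   | i , lower , upper =
    F.suc i ,
    subst (cap F.zero + offset n (cap ∘ F.suc) i ≤_) (add-sub s (cap F.zero)) (QP.+-monoʳ-≤ (cap F.zero) lower) ,
    subst₂ _<_ (add-sub s (cap F.zero)) (sym (QP.+-assoc (cap F.zero) _ _)) (QP.+-monoʳ-< (cap F.zero) upper)

  0<width : ∀ {a s w} → a ≤ s → s < a + w → 0ℚ < w
  0<width {a} {s} {w} a≤s s<a+w =
    subst₂ _<_ (QP.+-inverseʳ a) (sub-add a w) (QP.+-monoˡ-< (- a) (QP.≤-<-trans a≤s s<a+w))

  -- What the segment [a, b) can still receive from position s on, if every job that
  -- starts inside it has size at most δ.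
  slack : (a b δ s : ℚ) → ℚ
  slack a b δ s = (b + δ - (s ⊔ a)) ⊔ 0ℚ

  module _ {a b δ : ℚ} where

    slack-nonNeg : ∀ s → 0ℚ ≤ slack a b δ s
    slack-nonNeg s = QP.p≤q⊔p (b + δ - (s ⊔ a)) 0ℚ

    slack-antimono : ∀ {s s′} → s ≤ s′ → slack a b δ s′ ≤ slack a b δ s
    slack-antimono s≤s′ = QP.⊔-monoˡ-≤ 0ℚ (QP.+-monoʳ-≤ (b + δ) (QP.neg-antimono-≤ (QP.⊔-monoˡ-≤ a s≤s′)))

    slack-step : ∀ {s p} → a ≤ s → s < b → 0ℚ ≤ p → p ≤ δ → p + slack a b δ (s + p) ≤ slack a b δ s
    slack-step {s} {p} a≤s s<b 0≤p p≤δ = begin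
      p + slack a b δ (s + p)    ≤⟨ QP.+-monoʳ-≤ p (QP.⊔-lub (QP.≤-reflexive rest≡) 0≤rest) ⟩
      p + (b + δ - s - p)        ≡⟨ cancel b δ s p ⟩
      b + δ - s                  ≡⟨ cong (λ x → b + δ - x) (sym (QP.p≥q⇒p⊔q≡p a≤s)) ⟩
      b + δ - (s ⊔ a)            ≤⟨ QP.p≤p⊔q _ 0ℚ ⟩
      slack a b δ s              ∎
      where
      open QP.≤-Reasoning
      open QS.+-*-Solver
      cancel : ∀ b δ s p → p + (b + δ - s - p) ≡ b + δ - s
      cancel = solve 4 (λ b δ s p → p :+ (b :+ δ :- s :- p) := b :+ δ :- s) refl
      regroup : ∀ b δ s p → b + δ - (s + p) ≡ b + δ - s - p
      regroup = solve 4 (λ b δ s p → b :+ δ :- (s :+ p) := b :+ δ :- s :- p) refl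
      regroup′ : ∀ b δ s p → (b - s) + (δ - p) ≡ b + δ - s - p
      regroup′ = solve 4 (λ b δ s p → (b :- s) :+ (δ :- p) := b :+ δ :- s :- p) refl
      rest≡ : b + δ - ((s + p) ⊔ a) ≡ b + δ - s - p
      rest≡ = trans (cong (λ x → b + δ - x) (QP.p≥q⇒p⊔q≡p (QP.≤-trans a≤s (p≤p+q s 0≤p)))) (regroup b δ s p)
      0≤rest : 0ℚ ≤ b + δ - s - p
      0≤rest = subst (0ℚ ≤_) (regroup′ b δ s p) (QP.+-mono-≤ (p≤q⇒0≤q-p (QP.<⇒≤ s<b)) (p≤q⇒0≤q-p p≤δ))

  slack-0 : ∀ {a cap δ} → 0ℚ ≤ a → 0ℚ ≤ cap → 0ℚ ≤ δ → slack a (a + cap) δ 0ℚ ≤ cap + δ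
  slack-0 {a} {cap} {δ} 0≤a 0≤cap 0≤δ =
    QP.⊔-lub (QP.≤-reflexive (trans (cong (λ x → a + cap + δ - x) (QP.p≤q⇒p⊔q≡q 0≤a)) (cancel a cap δ)))
             (QP.+-mono-≤ 0≤cap 0≤δ)
    where
    open QS.+-*-Solver
    cancel : ∀ a c δ → a + c + δ - a ≡ c + δ
    cancel = solve 3 (λ a c δ → a :+ c :+ δ :- a := c :+ δ) refl

  split-map-++ : ∀ {A B : Set} (f : A → B) L ys zs → map f L ≡ ys ++ zs →
    ∃ λ L₁ → ∃ λ L₂ → L ≡ L₁ ++ L₂ × map f L₁ ≡ ys × map f L₂ ≡ zs
  split-map-++ f L       []       zs eq = [] , L , refl , refl , eq
  split-map-++ f (x ∷ L) (y ∷ ys) zs eq with split-map-++ f L ys zs (LP.∷-injectiveʳ eq)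
  ... | L₁ , L₂ , L≡ , eq₁ , eq₂ = x ∷ L₁ , L₂ , cong (x ∷_) L≡ , cong₂ _∷_ (LP.∷-injectiveˡ eq) eq₁ , eq₂

  filter-interleaving : ∀ {A : Set} {P : A → Set} (P? : ∀ x → Dec (P x)) xs →
                        Interleaving (filter P? xs) (filter (¬? ∘ P?) xs) xs
  filter-interleaving P? []       = []
  filter-interleaving P? (x ∷ xs) with P? x
  ... | yes _ = refl ∷ˡ filter-interleaving P? xs
  ... | no _  = refl ∷ʳ filter-interleaving P? xs

  module Assignments (m c : ℕ) where

    JobData : Set
    JobData = Fin c × ℚ

    Entry : Set
    Entry = Fin m × JobData

    size : Entry → ℚ
    size = proj₂ ∘ proj₂

    classWork : List JobData → Fin c → ℚ
    classWork []              k = 0ℚ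
    classWork ((k′ , p) ∷ ys) k = select (k′ ≟ᶠ k) p + classWork ys k

    work : List Entry → Fin m → Fin c → ℚ
    work []                   i k = 0ℚ
    work ((i′ , k′ , p) ∷ L) i k = select (i′ ≟ᶠ i) (select (k′ ≟ᶠ k) p) + work L i k

    machineWork : List Entry → Fin m → ℚ
    machineWork []                  i = 0ℚ
    machineWork ((i′ , _ , p) ∷ L) i = select (i′ ≟ᶠ i) p + machineWork L i

    Present : List Entry → Fin m → Fin c → Set
    Present L i k = Any (λ e → proj₁ e ≡ i × proj₁ (proj₂ e) ≡ k) L

    present? : ∀ L i k → Dec (Present L i k)
    present? L i k = Any.any? (λ e → (proj₁ e ≟ᶠ i) ×-dec (proj₁ (proj₂ e) ≟ᶠ k)) L

    classWork-++ : ∀ ys zs k → classWork (ys ++ zs) k ≡ classWork ys k + classWork zs k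
    classWork-++ []              zs k = sym (QP.+-identityˡ _)
    classWork-++ ((k′ , p) ∷ ys) zs k =
      trans (cong (select (k′ ≟ᶠ k) p +_) (classWork-++ ys zs k))
            (sym (QP.+-assoc (select (k′ ≟ᶠ k) p) (classWork ys k) (classWork zs k)))

    work-++ : ∀ L L′ i k → work (L ++ L′) i k ≡ work L i k + work L′ i k
    work-++ []                   L′ i k = sym (QP.+-identityˡ _)
    work-++ ((i′ , k′ , p) ∷ L) L′ i k =
      trans (cong (x +_) (work-++ L L′ i k)) (sym (QP.+-assoc x (work L i k) (work L′ i k)))
      where x = select (i′ ≟ᶠ i) (select (k′ ≟ᶠ k) p)

    select-entry-no : ∀ (i′ : Fin m) (k′ : Fin c) p i k → ¬ (i′ ≡ i × k′ ≡ k) →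
                      select (i′ ≟ᶠ i) (select (k′ ≟ᶠ k) p) ≡ 0ℚ
    select-entry-no i′ k′ p i k ¬same with i′ ≟ᶠ i
    ... | no _     = refl
    ... | yes i′≡i = select-no (k′ ≟ᶠ k) (λ k′≡k → ¬same (i′≡i , k′≡k)) p

    work-absent : ∀ L i k → ¬ Present L i k → work L i k ≡ 0ℚ
    work-absent []                   i k _ = refl
    work-absent ((i′ , k′ , p) ∷ L) i k ¬present =
      cong₂ _+_ (select-entry-no i′ k′ p i k (¬present ∘ here)) (work-absent L i k (¬present ∘ there))

    work≢0⇒present : ∀ L i k → work L i k ≢ 0ℚ → Present L i k
    work≢0⇒present L i k work≢0 with present? L i k
    ... | yes present = present
    ... | no absent   = ⊥-elim (work≢0 (work-absent L i k absent))

    classWork-nonNeg : ∀ ys k → All ((0ℚ ≤_) ∘ proj₂) ys → 0ℚ ≤ classWork ys k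
    classWork-nonNeg []              k []         = QP.≤-refl
    classWork-nonNeg ((k′ , p) ∷ ys) k (0≤p ∷ hs) = QP.+-mono-≤ (select-nonNeg (k′ ≟ᶠ k) 0≤p) (classWork-nonNeg ys k hs)

    work-nonNeg : ∀ L i k → All ((0ℚ ≤_) ∘ size) L → 0ℚ ≤ work L i k
    work-nonNeg []                   i k []         = QP.≤-refl
    work-nonNeg ((i′ , k′ , p) ∷ L) i k (0≤p ∷ hs) =
      QP.+-mono-≤ (select-nonNeg (i′ ≟ᶠ i) (select-nonNeg (k′ ≟ᶠ k) 0≤p)) (work-nonNeg L i k hs)

    work-pos : ∀ L i k → All ((0ℚ <_) ∘ size) L → Present L i k → 0ℚ < work L i k
    work-pos ((i′ , k′ , p) ∷ L) i k (0<p ∷ hs) (here (refl , refl)) =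
      QP.+-mono-<-≤ (subst (0ℚ <_) (sym (trans (select-yes (i′ ≟ᶠ i′) refl _) (select-yes (k′ ≟ᶠ k′) refl p))) 0<p)
                    (work-nonNeg L i k (All.map QP.<⇒≤ hs))
    work-pos ((i′ , k′ , p) ∷ L) i k (0<p ∷ hs) (there present) =
      QP.+-mono-≤-< (select-nonNeg (i′ ≟ᶠ i) (select-nonNeg (k′ ≟ᶠ k) (QP.<⇒≤ 0<p))) (work-pos L i k hs present)

    map-proj₂-filter : ∀ {Q : JobData → Set} (Q? : ∀ x → Dec (Q x)) (L : List Entry) →
                       map proj₂ (filter (Q? ∘ proj₂) L) ≡ filter Q? (map proj₂ L)
    map-proj₂-filter Q? []      = refl
    map-proj₂-filter Q? (e ∷ L) with Q? (proj₂ e)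
    ... | yes _ = cong (proj₂ e ∷_) (map-proj₂-filter Q? L)
    ... | no _  = map-proj₂-filter Q? L

    sumFin-work-machines : ∀ L k → sumFin m (λ i → work L i k) ≡ classWork (map proj₂ L) k
    sumFin-work-machines []                   k = sumFin-0 m (λ _ → refl)
    sumFin-work-machines ((i′ , k′ , p) ∷ L) k =
      trans (sumFin-+ m _ _) (cong₂ _+_ (sumFin-selectʳ m i′ (select (k′ ≟ᶠ k) p)) (sumFin-work-machines L k))

    sumFin-work-classes : ∀ L i → sumFin c (λ k → work L i k) ≡ machineWork L i
    sumFin-work-classes []                   i = sumFin-0 c (λ _ → refl)
    sumFin-work-classes ((i′ , k′ , p) ∷ L) i = trans (sumFin-+ c _ _) (cong₂ _+_ onHead (sumFin-work-classes L i))
      where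
      onHead : sumFin c (λ k → select (i′ ≟ᶠ i) (select (k′ ≟ᶠ k) p)) ≡ select (i′ ≟ᶠ i) p
      onHead with i′ ≟ᶠ i
      ... | yes _ = sumFin-selectʳ c k′ p
      ... | no _  = sumFin-0 c (λ _ → refl)

    classWork-replicate : ∀ r k′ d k → classWork (replicate r (k′ , d)) k ≡ select (k′ ≟ᶠ k) (r · d)
    classWork-replicate zero    k′ d k = sym (select-0 (k′ ≟ᶠ k))
    classWork-replicate (suc r) k′ d k =
      trans (cong (select (k′ ≟ᶠ k) d +_) (classWork-replicate r k′ d k)) (sym (select-+ (k′ ≟ᶠ k) d (r · d)))

    onMachines : Fin c → ℚ → List (Fin m) → List Entry
    onMachines k d = map (λ i → i , k , d)

    map-proj₂-onMachines : ∀ k d l → map proj₂ (onMachines k d l) ≡ replicate (length l) (k , d)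
    map-proj₂-onMachines k d []      = refl
    map-proj₂-onMachines k d (_ ∷ l) = cong ((k , d) ∷_) (map-proj₂-onMachines k d l)

    work-onMachines : ∀ k d l i k′ → work (onMachines k d l) i k′ ≡ select (k ≟ᶠ k′) (multiplicity i l · d)
    work-onMachines k d []       i k′ = sym (select-0 (k ≟ᶠ k′))
    work-onMachines k d (i′ ∷ l) i k′ with i′ ≟ᶠ i
    ... | yes _ = trans (cong (select (k ≟ᶠ k′) d +_) (work-onMachines k d l i k′)) (sym (select-+ (k ≟ᶠ k′) d _))
    ... | no _  = trans (QP.+-identityˡ _) (work-onMachines k d l i k′)

    work-concatMap : ∀ {A : Set} n (g : Fin n → A) (f : A → List Entry) i k →
      work (concatMap f (tabulate g)) i k ≡ sumFin n (λ j → work (f (g j)) i k)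
    work-concatMap zero    g f i k = refl
    work-concatMap (suc n) g f i k =
      trans (work-++ (f (g F.zero)) _ i k) (cong (work (f (g F.zero)) i k +_) (work-concatMap n (g ∘ F.suc) f i k))

    classWork-concatMap : ∀ {A : Set} n (g : Fin n → A) (f : A → List JobData) k →
      classWork (concatMap f (tabulate g)) k ≡ sumFin n (λ j → classWork (f (g j)) k)
    classWork-concatMap zero    g f k = refl
    classWork-concatMap (suc n) g f k =
      trans (classWork-++ (f (g F.zero)) _ k) (cong (classWork (f (g F.zero)) k +_) (classWork-concatMap n (g ∘ F.suc) f k))

    cost : (Fin c → ℚ) → List Entry → Fin m → ℚ
    cost s L i = sumFin c (λ k → work L i k + select (present? L i k) (s k))

    record Absorbed (ε : ℚ) (s : Fin c → ℚ) (L L′ : List Entry) : Set where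
      field
        present-⊆ : ∀ i k → Present L′ i k → Present L i k
        work-≤    : ∀ i k → work L′ i k ≤ work L i k + ε * s k

    classCost-absorbed : ∀ {P P′ : Set} (P? : Dec P) (P′? : Dec P′) {ε s w w′} → 0ℚ ≤ ε → 0ℚ ≤ s → 0ℚ ≤ w →
      (P′ → P) → w′ ≤ w + ε * s → (¬ P′ → w′ ≡ 0ℚ) → w′ + select P′? s ≤ (1ℚ + ε) * (w + select P? s)
    classCost-absorbed (yes _) (yes _)  {ε} {s} {w} {w′} 0≤ε _ 0≤w _ w′≤ _ = begin
      w′ + s                       ≤⟨ QP.+-monoˡ-≤ s w′≤ ⟩
      w + ε * s + s                ≤⟨ p≤p+q (w + ε * s + s) (0≤* 0≤ε 0≤w) ⟩
      w + ε * s + s + ε * w        ≡⟨ expand ε w s ⟨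
      (1ℚ + ε) * (w + s)           ∎
      where
      open QP.≤-Reasoning
      open QS.+-*-Solver
      expand : ∀ e w s → (1ℚ + e) * (w + s) ≡ w + e * s + s + e * w
      expand = solve 3 (λ e w s → (con 1ℚ :+ e) :* (w :+ s) := w :+ e :* s :+ s :+ e :* w) refl
    classCost-absorbed (no ¬p) (yes p′) _ _ _ p′⇒p _ _ = ⊥-elim (¬p (p′⇒p p′))
    classCost-absorbed P? (no ¬p′) {ε} {s} {w} {w′} 0≤ε 0≤s 0≤w _ _ absent =
      subst (_≤ (1ℚ + ε) * (w + select P? s)) (sym (trans (QP.+-identityʳ w′) (absent ¬p′)))
        (0≤* (0≤1+p 0≤ε) (QP.+-mono-≤ 0≤w (select-nonNeg P? 0≤s)))

    cost-absorbed : ∀ {ε s L L′} → 0ℚ ≤ ε → (∀ k → 0ℚ ≤ s k) → All ((0ℚ ≤_) ∘ size) L →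
      Absorbed ε s L L′ → ∀ i → cost s L′ i ≤ (1ℚ + ε) * cost s L i
    cost-absorbed {ε} {s} {L} {L′} 0≤ε 0≤s 0≤L absorbed i =
      subst (cost s L′ i ≤_) (sumFin-*ˡ c (1ℚ + ε) _) (sumFin-mono-≤ c λ k →
        classCost-absorbed (present? L i k) (present? L′ i k) 0≤ε (0≤s k) (work-nonNeg L i k 0≤L)
          (present-⊆ i k) (work-≤ i k) (work-absent L′ i k))
      where open Absorbed absorbed

    LoadsAtMost : (Fin c → ℚ) → (Fin m → ℚ) → List Entry → ℚ → Set
    LoadsAtMost s v L T = ∀ i → cost s L i /? v i ≤ T

    loads-absorbed : ∀ {ε s v L L′ T} → 0ℚ ≤ ε → (∀ k → 0ℚ ≤ s k) → (∀ i → 0ℚ < v i) → All ((0ℚ ≤_) ∘ size) L →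
      Absorbed ε s L L′ → LoadsAtMost s v L T → LoadsAtMost s v L′ ((1ℚ + ε) * T)
    loads-absorbed {ε} {s} {v} {L} {L′} {T} 0≤ε 0≤s 0<v 0≤L absorbed L≤T i =
      /?-≤ (cost s L′ i) ((1ℚ + ε) * T) (0<v i) (begin
        cost s L′ i             ≤⟨ cost-absorbed 0≤ε 0≤s 0≤L absorbed i ⟩
        (1ℚ + ε) * cost s L i   ≤⟨ QP.*-monoˡ-≤-nonNeg (1ℚ + ε) {{Q.nonNegative (0≤1+p 0≤ε)}} L≤Tv ⟩
        (1ℚ + ε) * (T * v i)    ≡⟨ QP.*-assoc (1ℚ + ε) T (v i) ⟨
        (1ℚ + ε) * T * v i      ∎)
      where
      open QP.≤-Reasoning
      L≤Tv = /?-≤⁻ (cost s L i) T (0<v i) (L≤T i)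

    work-interleaving : ∀ {L₁ L₂ L} → Interleaving L₁ L₂ L → ∀ i k → work L i k ≡ work L₁ i k + work L₂ i k
    work-interleaving []                      i k = refl
    work-interleaving (_∷ˡ_ {a = (i′ , k′ , p)} {l = L₁} {r = L₂} refl sp) i k =
      trans (cong (x +_) (work-interleaving sp i k)) (sym (QP.+-assoc x (work L₁ i k) (work L₂ i k)))
      where x = select (i′ ≟ᶠ i) (select (k′ ≟ᶠ k) p)
    work-interleaving (_∷ʳ_ {b = (i′ , k′ , p)} {l = L₁} {r = L₂} refl sp) i k =
      trans (cong (x +_) (work-interleaving sp i k)) (x∙yz≈y∙xz x (work L₁ i k) (work L₂ i k))
      where x = select (i′ ≟ᶠ i) (select (k′ ≟ᶠ k) p)

    present-interleaving : ∀ {L₁ L₂ L} → Interleaving L₁ L₂ L → ∀ {i k} →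
                           Present L i k → Present L₁ i k ⊎ Present L₂ i k
    present-interleaving (refl ∷ˡ sp) (here same)    = inj₁ (here same)
    present-interleaving (refl ∷ʳ sp) (here same)    = inj₂ (here same)
    present-interleaving (refl ∷ˡ sp) (there present) = map₁ there (present-interleaving sp present)
    present-interleaving (refl ∷ʳ sp) (there present) = map₂ there (present-interleaving sp present)

    interleave-filter : ∀ {Q : JobData → Set} (Q? : ∀ x → Dec (Q x)) xs (L₁ L₂ : List Entry) →
      map proj₂ L₁ ≡ filter Q? xs → map proj₂ L₂ ≡ filter (¬? ∘ Q?) xs →
      ∃ λ L → map proj₂ L ≡ xs × Interleaving L₁ L₂ L
    interleave-filter Q? []       []       []       _   _   = [] , refl , []
    interleave-filter Q? (x ∷ xs) L₁ L₂ eq₁ eq₂ with Q? x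
    interleave-filter Q? (x ∷ xs) (e ∷ L₁) L₂ eq₁ eq₂ | yes _
      with interleave-filter Q? xs L₁ L₂ (LP.∷-injectiveʳ eq₁) eq₂
    ... | L , L≡ , sp = e ∷ L , cong₂ _∷_ (LP.∷-injectiveˡ eq₁) L≡ , refl ∷ˡ sp
    interleave-filter Q? (x ∷ xs) L₁ (e ∷ L₂) eq₁ eq₂ | no _
      with interleave-filter Q? xs L₁ L₂ eq₁ (LP.∷-injectiveʳ eq₂)
    ... | L , L≡ , sp = e ∷ L , cong₂ _∷_ (LP.∷-injectiveˡ eq₂) L≡ , refl ∷ʳ sp

  module _ {m c : ℕ} where
    open Assignments m c

    assign : (xs : List JobData) → (Fin (length xs) → Fin m) → List Entry
    assign xs σ = tabulate (λ j → σ j , lookup xs j)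

    map-proj₂-assign : ∀ xs σ → map proj₂ (assign xs σ) ≡ xs
    map-proj₂-assign xs σ = trans (LP.map-tabulate _ proj₂) (LP.tabulate-lookup xs)

    assign-onto : ∀ xs (L : List Entry) → map proj₂ L ≡ xs → ∃ λ σ → assign xs σ ≡ L
    assign-onto _ []      refl = (λ ()) , refl
    assign-onto _ (e ∷ L) refl with assign-onto _ L refl
    ... | σ , assign≡L = σ′ , cong (e ∷_) assign≡L
      where
      σ′ : Fin (suc (length (map proj₂ L))) → Fin m
      σ′ F.zero    = proj₁ e
      σ′ (F.suc j) = σ j

    assign-pos : ∀ xs σ → All ((0ℚ <_) ∘ proj₂) xs → All ((0ℚ <_) ∘ size) (assign xs σ)
    assign-pos xs σ 0<xs = AllP.map⁻ (subst (All ((0ℚ <_) ∘ proj₂)) (sym (map-proj₂-assign xs σ)) 0<xs)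

    machineWork-tabulate : ∀ n (h : Fin n → Entry) i →
      sumFin n (λ j → select (proj₁ (h j) ≟ᶠ i) (size (h j))) ≡ machineWork (tabulate h) i
    machineWork-tabulate zero    h i = refl
    machineWork-tabulate (suc n) h i =
      cong (select (proj₁ (h F.zero) ≟ᶠ i) (size (h F.zero)) +_) (machineWork-tabulate n (h ∘ F.suc) i)

  module _ (I : Instance) where
    open Assignments (m I) (c I)

    assignment : Schedule I → List Entry
    assignment = assign (jobs I)

    load≡cost : ∀ σ i → load I σ i ≡ cost (setup I) (assignment σ) i /? speed I i
    load≡cost σ i = cong (_/? speed I i) (begin
      sumFin (length (jobs I)) (λ j → select (σ j ≟ᶠ i) (jobSize I j)) + sumFin (c I) setupCharge
        ≡⟨ cong (_+ sumFin (c I) setupCharge) (machineWork-tabulate _ (λ j → σ j , lookup (jobs I) j) i) ⟩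
      machineWork L i + sumFin (c I) setupCharge
        ≡⟨ cong₂ _+_ (sym (sumFin-work-classes L i)) (sumFin-cong (c I) setupCharge≡) ⟩
      sumFin (c I) (λ k → work L i k) + sumFin (c I) (λ k → select (present? L i k) (setup I k))
        ≡⟨ sumFin-+ (c I) _ _ ⟨
      cost (setup I) L i ∎)
      where
      open ≡-Reasoning
      L = assignment σ
      used? : ∀ k → Dec (∃ λ j → σ j ≡ i × jobClass I j ≡ k)
      used? k = any? (λ j → (σ j ≟ᶠ i) ×-dec (jobClass I j ≟ᶠ k))
      setupCharge : Fin (c I) → ℚ
      setupCharge k = select (used? k) (setup I k)
      setupCharge≡ : ∀ k → setupCharge k ≡ select (present? L i k) (setup I k)
      setupCharge≡ k = select-cong (used? k) (present? L i k) (λ (j , used) → AnyP.tabulate⁺ j used) AnyP.tabulate⁻ (setup I k)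

    makespan⇒loads : ∀ σ {T} → MakespanAtMost I σ T → LoadsAtMost (setup I) (speed I) (assignment σ) T
    makespan⇒loads σ {T} σ≤T i = subst (_≤ T) (load≡cost σ i) (σ≤T i)

    loads⇒makespan : ∀ σ {T} → LoadsAtMost (setup I) (speed I) (assignment σ) T → MakespanAtMost I σ T
    loads⇒makespan σ {T} σ≤T i = subst (_≤ T) (sym (load≡cost σ i)) (σ≤T i)

  -- Rounding the small jobs

  module Rounding (I : Instance) {ε : ℚ} (0<ε : 0ℚ < ε) (positive : PositiveInstance I) where
    open Assignments (m I) (c I)

    δ : Fin (c I) → ℚ
    δ k = ε * setup I k

    0<δ : ∀ k → 0ℚ < δ k
    0<δ k = 0<* 0<ε (proj₁ (proj₂ positive) k)

    large? : (x : JobData) → Dec (¬ (proj₂ x ≤ δ (proj₁ x)))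
    large? = ¬? ∘ small? I ε

    newJobs : List JobData
    newJobs = concatMap (λ k → replicate (newCount I ε k) (k , δ k)) (allFin (c I))

    smalls : List JobData
    smalls = filter (small? I ε) (jobs I)

    smallTotal≡classWork : ∀ k → smallTotal I ε k ≡ classWork smalls k
    smallTotal≡classWork k = go (jobs I)
      where
      ofClass? : (x : JobData) → Dec (proj₁ x ≡ k × proj₂ x ≤ δ (proj₁ x))
      ofClass? x = (proj₁ x ≟ᶠ k) ×-dec small? I ε x
      go : ∀ ys → foldr _+_ 0ℚ (map proj₂ (filter ofClass? ys)) ≡ classWork (filter (small? I ε) ys) k
      go []       = refl
      go (x ∷ ys) = step (proj₁ x ≟ᶠ k) (small? I ε x)
        where
        step : Dec (proj₁ x ≡ k) → Dec (proj₂ x ≤ δ (proj₁ x)) →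
          foldr _+_ 0ℚ (map proj₂ (filter ofClass? (x ∷ ys))) ≡ classWork (filter (small? I ε) (x ∷ ys)) k
        step (yes x∈k) (yes s)
          rewrite LP.filter-accept ofClass? {x} {ys} (x∈k , s) | LP.filter-accept (small? I ε) {x} {ys} s
          = cong₂ _+_ (sym (select-yes (proj₁ x ≟ᶠ k) x∈k (proj₂ x))) (go ys)
        step (no x∉k) (yes s)
          rewrite LP.filter-reject ofClass? {x} {ys} (x∉k ∘ proj₁) | LP.filter-accept (small? I ε) {x} {ys} s
          = trans (go ys) (sym (trans (cong (_+ _) (select-no (proj₁ x ≟ᶠ k) x∉k (proj₂ x))) (QP.+-identityˡ _)))
        step _ (no ¬s)
          rewrite LP.filter-reject ofClass? {x} {ys} (¬s ∘ proj₂) | LP.filter-reject (small? I ε) {x} {ys} ¬s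
          = go ys

    0<jobs : All ((0ℚ <_) ∘ proj₂) (jobs I)
    0<jobs = subst (All ((0ℚ <_) ∘ proj₂)) (LP.tabulate-lookup (jobs I)) (AllP.tabulate⁺ (proj₂ (proj₂ positive)))

    0<newJobs : All ((0ℚ <_) ∘ proj₂) newJobs
    0<newJobs = AllP.concat⁺ (AllP.map⁺ (AllP.tabulate⁺ (λ k → AllP.replicate⁺ (newCount I ε k) (0<δ k))))

    0<jobs₂ : All ((0ℚ <_) ∘ proj₂) (jobs (I₂ I ε))
    0<jobs₂ = AllP.++⁺ (AllP.filter⁺ large? 0<jobs) 0<newJobs

    0≤smallTotal : ∀ k → 0ℚ ≤ smallTotal I ε k
    0≤smallTotal k = subst (0ℚ ≤_) (sym (smallTotal≡classWork k))
                       (classWork-nonNeg smalls k (AllP.filter⁺ (small? I ε) (All.map QP.<⇒≤ 0<jobs)))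

    newCount-bounds : ∀ k → smallTotal I ε k ≤ newCount I ε k · δ k × newCount I ε k · δ k < smallTotal I ε k + δ k
    newCount-bounds k = ceilCount-bounds (smallTotal I ε k) (0<δ k) (0≤smallTotal k)

    classWork-newJobs : ∀ k → classWork newJobs k ≡ newCount I ε k · δ k
    classWork-newJobs k = begin
      classWork newJobs k
        ≡⟨ classWork-concatMap (c I) id (λ k′ → replicate (newCount I ε k′) (k′ , δ k′)) k ⟩
      sumFin (c I) (λ k′ → classWork (replicate (newCount I ε k′) (k′ , δ k′)) k)
        ≡⟨ sumFin-cong (c I) (λ k′ → classWork-replicate (newCount I ε k′) k′ (δ k′) k) ⟩
      sumFin (c I) (λ k′ → select (k′ ≟ᶠ k) (newCount I ε k′ · δ k′))
        ≡⟨ sumFin-selectˡ (c I) k (λ k′ → newCount I ε k′ · δ k′) ⟩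
      newCount I ε k · δ k ∎
      where open ≡-Reasoning

    module ToRounded (σ : Schedule I) where
      L : List Entry
      L = assignment I σ

      smallPart largePart : List Entry
      smallPart = filter (small? I ε ∘ proj₂) L
      largePart = filter (large? ∘ proj₂) L

      work-L : ∀ i k → work L i k ≡ work smallPart i k + work largePart i k
      work-L = work-interleaving (filter-interleaving (small? I ε ∘ proj₂) L)

      quota : Fin (c I) → Fin (m I) → ℕ
      quota k i = ceilCount (work smallPart i k) (δ k)

      quota-bounds : ∀ i k → work smallPart i k ≤ quota k i · δ k × quota k i · δ k < work smallPart i k + δ k
      quota-bounds i k = ceilCount-bounds (work smallPart i k) (0<δ k)
                           (work-nonNeg smallPart i k (AllP.filter⁺ _ (All.map QP.<⇒≤ (assign-pos (jobs I) σ 0<jobs))))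

      machinesFor : Fin (c I) → List (Fin (m I))
      machinesFor k = take (newCount I ε k) (withMultiplicities (m I) (quota k))

      newPart L₂ : List Entry
      newPart = concatMap (λ k → onMachines k (δ k) (machinesFor k)) (allFin (c I))
      L₂ = largePart ++ newPart

      sumFin-smallPart : ∀ k → sumFin (m I) (λ i → work smallPart i k) ≡ smallTotal I ε k
      sumFin-smallPart k = begin
        sumFin (m I) (λ i → work smallPart i k)    ≡⟨ sumFin-work-machines smallPart k ⟩
        classWork (map proj₂ smallPart) k          ≡⟨ cong (λ ys → classWork ys k) (map-proj₂-filter (small? I ε) L) ⟩
        classWork (filter (small? I ε) (map proj₂ L)) k
          ≡⟨ cong (λ ys → classWork (filter (small? I ε) ys) k) (map-proj₂-assign (jobs I) σ) ⟩
        classWork smalls k                         ≡⟨ smallTotal≡classWork k ⟨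
        smallTotal I ε k                           ∎
        where open ≡-Reasoning

      newCount≤ : ∀ k → newCount I ε k ℕ.≤ length (withMultiplicities (m I) (quota k))
      newCount≤ k = ℕP.<⇒≤pred (·-cancelʳ-< (newCount I ε k) (suc l) (QP.<⇒≤ (0<δ k)) (begin-strict
        newCount I ε k · δ k                          <⟨ proj₂ (newCount-bounds k) ⟩
        smallTotal I ε k + δ k                        ≡⟨ cong (_+ δ k) (sumFin-smallPart k) ⟨
        sumFin (m I) (λ i → work smallPart i k) + δ k
          ≤⟨ QP.+-monoˡ-≤ (δ k) (sumFin-mono-≤ (m I) (λ i → proj₁ (quota-bounds i k))) ⟩
        sumFin (m I) (λ i → quota k i · δ k) + δ k
          ≡⟨ cong (_+ δ k) (length-withMultiplicities-· (m I) (quota k) (δ k)) ⟨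
        l · δ k + δ k                                 ≡⟨ QP.+-comm (l · δ k) (δ k) ⟩
        suc l · δ k                                   ∎))
        where
        open QP.≤-Reasoning
        l = length (withMultiplicities (m I) (quota k))

      length-machinesFor : ∀ k → length (machinesFor k) ≡ newCount I ε k
      length-machinesFor k = trans (LP.length-take (newCount I ε k) _) (ℕP.m≤n⇒m⊓n≡m (newCount≤ k))

      map-proj₂-L₂ : map proj₂ L₂ ≡ jobs (I₂ I ε)
      map-proj₂-L₂ = trans (LP.map-++ proj₂ largePart newPart) (cong₂ _++_ large≡ new≡)
        where
        large≡ : map proj₂ largePart ≡ filter large? (jobs I)
        large≡ = trans (map-proj₂-filter large? L) (cong (filter large?) (map-proj₂-assign (jobs I) σ))
        new≡ : map proj₂ newPart ≡ newJobs
        new≡ = trans (LP.map-concatMap proj₂ _ (allFin (c I))) (LP.concatMap-cong (λ k →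
                 trans (map-proj₂-onMachines k (δ k) (machinesFor k)) (cong (λ r → replicate r (k , δ k)) (length-machinesFor k)))
                 (allFin (c I)))

      work-newPart : ∀ i k → work newPart i k ≡ multiplicity i (machinesFor k) · δ k
      work-newPart i k = begin
        work newPart i k
          ≡⟨ work-concatMap (c I) id (λ k′ → onMachines k′ (δ k′) (machinesFor k′)) i k ⟩
        sumFin (c I) (λ k′ → work (onMachines k′ (δ k′) (machinesFor k′)) i k)
          ≡⟨ sumFin-cong (c I) (λ k′ → work-onMachines k′ (δ k′) (machinesFor k′) i k) ⟩
        sumFin (c I) (λ k′ → select (k′ ≟ᶠ k) (multiplicity i (machinesFor k′) · δ k′))
          ≡⟨ sumFin-selectˡ (c I) k (λ k′ → multiplicity i (machinesFor k′) · δ k′) ⟩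
        multiplicity i (machinesFor k) · δ k ∎
        where open ≡-Reasoning

      multiplicity≤quota : ∀ i k → multiplicity i (machinesFor k) ℕ.≤ quota k i
      multiplicity≤quota i k = subst (multiplicity i (machinesFor k) ℕ.≤_) (multiplicity-withMultiplicities (m I) (quota k) i)
                                 (multiplicity-take i (newCount I ε k) _)

      work-newPart≤ : ∀ i k → work newPart i k ≤ work smallPart i k + δ k
      work-newPart≤ i k = begin
        work newPart i k                          ≡⟨ work-newPart i k ⟩
        multiplicity i (machinesFor k) · δ k      ≤⟨ ·-monoˡ-≤ (δ k) (QP.<⇒≤ (0<δ k)) (multiplicity≤quota i k) ⟩
        quota k i · δ k                           ≤⟨ QP.<⇒≤ (proj₂ (quota-bounds i k)) ⟩
        work smallPart i k + δ k                  ∎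
        where open QP.≤-Reasoning

      new⇒small : ∀ i k → Present newPart i k → Present smallPart i k
      new⇒small i k present = work≢0⇒present smallPart i k λ small≡0 →
        QP.<-irrefl (sym (new≡0 small≡0)) (work-pos newPart i k 0<newPart present)
        where
        new≡0 : work smallPart i k ≡ 0ℚ → work newPart i k ≡ 0ℚ
        new≡0 small≡0 = begin
          work newPart i k                        ≡⟨ work-newPart i k ⟩
          multiplicity i (machinesFor k) · δ k
            ≡⟨ cong (_· δ k) (ℕP.n≤0⇒n≡0 (subst (multiplicity i (machinesFor k) ℕ.≤_) quota≡0 (multiplicity≤quota i k))) ⟩
          0 · δ k                                 ∎
          where
          open ≡-Reasoning
          quota≡0 : quota k i ≡ 0
          quota≡0 = trans (cong (λ w → ceilCount w (δ k)) small≡0) (ceilCount-0 (δ k))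
        0<newPart : All ((0ℚ <_) ∘ size) newPart
        0<newPart = AllP.concat⁺ (AllP.map⁺ (AllP.tabulate⁺ λ k′ →
                      AllP.map⁺ (All.universal (λ _ → 0<δ k′) (machinesFor k′))))

      absorbed : Absorbed ε (setup I) L L₂
      absorbed = record { present-⊆ = present-⊆ ; work-≤ = work-≤ }
        where
        present-⊆ : ∀ i k → Present L₂ i k → Present L i k
        present-⊆ i k present with AnyP.++⁻ largePart present
        ... | inj₁ inLarge = AnyP.filter⁻ (large? ∘ proj₂) inLarge
        ... | inj₂ inNew   = AnyP.filter⁻ (small? I ε ∘ proj₂) (new⇒small i k inNew)
        work-≤ : ∀ i k → work L₂ i k ≤ work L i k + δ k
        work-≤ i k = begin
          work L₂ i k                                      ≡⟨ work-++ largePart newPart i k ⟩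
          work largePart i k + work newPart i k            ≤⟨ QP.+-monoʳ-≤ (work largePart i k) (work-newPart≤ i k) ⟩
          work largePart i k + (work smallPart i k + δ k)  ≡⟨ x∙yz≈y∙xz (work largePart i k) (work smallPart i k) (δ k) ⟩
          work smallPart i k + (work largePart i k + δ k)  ≡⟨ QP.+-assoc (work smallPart i k) (work largePart i k) (δ k) ⟨
          work smallPart i k + work largePart i k + δ k    ≡⟨ cong (_+ δ k) (work-L i k) ⟨
          work L i k + δ k                                 ∎
          where open QP.≤-Reasoning

      absorbingSchedule : ∃ λ σ₂ → Absorbed ε (setup I) L (assignment (I₂ I ε) σ₂)
      absorbingSchedule = proj₁ onto , subst (Absorbed ε (setup I) L) (sym (proj₂ onto)) absorbed
        where onto = assign-onto (jobs (I₂ I ε)) L₂ map-proj₂-L₂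

    module FromRounded (σ₂ : Schedule (I₂ I ε)) where
      L₂ : List Entry
      L₂ = assignment (I₂ I ε) σ₂

      private
        L₂-split = split-map-++ proj₂ L₂ (filter large? (jobs I)) newJobs
                     (map-proj₂-assign (jobs (I₂ I ε)) σ₂)

      largePart newPart : List Entry
      largePart = proj₁ L₂-split
      newPart   = proj₁ (proj₂ L₂-split)

      L₂≡ : L₂ ≡ largePart ++ newPart
      L₂≡ = proj₁ (proj₂ (proj₂ L₂-split))

      map-proj₂-largePart : map proj₂ largePart ≡ filter large? (jobs I)
      map-proj₂-largePart = proj₁ (proj₂ (proj₂ (proj₂ L₂-split)))

      map-proj₂-newPart : map proj₂ newPart ≡ newJobs
      map-proj₂-newPart = proj₂ (proj₂ (proj₂ (proj₂ L₂-split)))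

      capacity : Fin (c I) → Fin (m I) → ℚ
      capacity k i = work newPart i k

      0≤capacity : ∀ k i → 0ℚ ≤ capacity k i
      0≤capacity k i = work-nonNeg newPart i k
        (AllP.map⁻ (subst (All ((0ℚ ≤_) ∘ proj₂)) (sym map-proj₂-newPart) (All.map QP.<⇒≤ 0<newJobs)))

      total : Fin (c I) → ℚ
      total k = sumFin (m I) (capacity k)

      smalls≤total : ∀ k → classWork smalls k ≤ total k
      smalls≤total k = subst₂ _≤_ (smallTotal≡classWork k) (sym total≡) (proj₁ (newCount-bounds k))
        where
        total≡ : total k ≡ newCount I ε k · δ k
        total≡ = trans (sumFin-work-machines newPart k)
                   (trans (cong (λ ys → classWork ys k) map-proj₂-newPart) (classWork-newJobs k))

      -- The new class-k jobs of σ₂ on machine i make up the segment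
      -- [start k i, start k i + capacity k i) of a line of length total k.
      start : Fin (c I) → Fin (m I) → ℚ
      start k = offset (m I) (capacity k)

      room : Fin (m I) → Fin (c I) → ℚ → ℚ
      room i k = slack (start k i) (start k i + capacity k i) (δ k)

      Small : JobData → Set
      Small (k , p) = 0ℚ < p × p ≤ δ k

      advance : (Fin (c I) → ℚ) → JobData → Fin (c I) → ℚ
      advance S (k , p) k′ = S k′ + select (k ≟ᶠ k′) p

      -- S k is the total size of the small class-k jobs placed so far, i.e. the position on
      -- the class-k line at which the next one starts.
      Fits : (Fin (c I) → ℚ) → List JobData → Set
      Fits S ys = ∀ k → 0ℚ ≤ S k × S k + classWork ys k ≤ total k

      fits-advance : ∀ S x ys → 0ℚ ≤ proj₂ x → Fits S (x ∷ ys) → Fits (advance S x) ys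
      fits-advance S (k′ , p) ys 0≤p fits k =
        QP.+-mono-≤ (proj₁ (fits k)) (select-nonNeg (k′ ≟ᶠ k) 0≤p) ,
        subst (_≤ total k) (sym (QP.+-assoc (S k) (select (k′ ≟ᶠ k) p) (classWork ys k))) (proj₂ (fits k))

      slot : ∀ S k p ys → 0ℚ < p → All Small ys → Fits S ((k , p) ∷ ys) →
        ∃ λ i → start k i ≤ S k × S k < start k i + capacity k i
      slot S k p ys 0<p small fits = interval-containing (m I) (capacity k) (proj₁ (fits k)) (begin-strict
        S k                                  <⟨ subst (_< S k + p) (QP.+-identityʳ (S k)) (QP.+-monoʳ-< (S k) 0<p) ⟩
        S k + p                              ≤⟨ QP.+-monoʳ-≤ (S k) (p≤p+q p 0≤rest) ⟩
        S k + (p + classWork ys k)           ≡⟨ cong (λ w → S k + (w + classWork ys k)) (select-yes (k ≟ᶠ k) refl p) ⟨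
        S k + classWork ((k , p) ∷ ys) k     ≤⟨ proj₂ (fits k) ⟩
        total k                              ∎)
        where
        open QP.≤-Reasoning
        0≤rest = classWork-nonNeg ys k (All.map (QP.<⇒≤ ∘ proj₁) small)

      place : ∀ S ys → All Small ys → Fits S ys → List Entry
      place S []             []                  fits = []
      place S ((k , p) ∷ ys) ((0<p , _) ∷ small) fits =
        (proj₁ (slot S k p ys 0<p small fits) , k , p)
          ∷ place (advance S (k , p)) ys small (fits-advance S (k , p) ys (QP.<⇒≤ 0<p) fits)

      map-proj₂-place : ∀ S ys small fits → map proj₂ (place S ys small fits) ≡ ys
      map-proj₂-place S []             []                  fits = refl
      map-proj₂-place S ((k , p) ∷ ys) ((0<p , _) ∷ small) fits =
        cong ((k , p) ∷_) (map-proj₂-place (advance S (k , p)) ys small (fits-advance S (k , p) ys (QP.<⇒≤ 0<p) fits))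

      room-step : ∀ {j i k s p w} → start k j ≤ s → s < start k j + capacity k j → 0ℚ ≤ p → p ≤ δ k →
        w ≤ room i k (s + p) → select (j ≟ᶠ i) p + w ≤ room i k s
      room-step {j} {i} {k} {s} {p} {w} lower upper 0≤p p≤δ w≤ with j ≟ᶠ i
      ... | yes refl = QP.≤-trans (QP.+-monoʳ-≤ p w≤) (slack-step lower upper 0≤p p≤δ)
      ... | no _     = subst (_≤ room i k s) (sym (QP.+-identityˡ w))
                         (QP.≤-trans w≤ (slack-antimono {start k i} {start k i + capacity k i} {δ k} (p≤p+q s 0≤p)))

      place-work : ∀ S ys small fits i k → work (place S ys small fits) i k ≤ room i k (S k)
      place-work S []               []                    fits i k =
        slack-nonNeg {start k i} {start k i + capacity k i} {δ k} (S k)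
      place-work S ((k′ , p) ∷ ys) ((0<p , p≤δ) ∷ small) fits i k
        with k′ ≟ᶠ k | place-work (advance S (k′ , p)) ys small (fits-advance S (k′ , p) ys (QP.<⇒≤ 0<p) fits) i k
      ... | yes refl | ih = room-step (proj₁ (proj₂ in-slot)) (proj₂ (proj₂ in-slot)) (QP.<⇒≤ 0<p) p≤δ ih
        where in-slot = slot S k p ys 0<p small fits
      ... | no _     | ih =
        subst₂ _≤_ (sym (trans (cong (_+ w) (select-0 (proj₁ (slot S k′ p ys 0<p small fits) ≟ᶠ i))) (QP.+-identityˡ w)))
                   (cong (room i k) (QP.+-identityʳ (S k))) ih
        where w = work (place (advance S (k′ , p)) ys small (fits-advance S (k′ , p) ys (QP.<⇒≤ 0<p) fits)) i k

      place-present : ∀ S ys small fits i k → Present (place S ys small fits) i k → 0ℚ < capacity k i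
      place-present S ((k , p) ∷ ys) ((0<p , _) ∷ small) fits i .k (here (j≡i , refl)) =
        subst (λ j → 0ℚ < capacity k j) j≡i (0<width (proj₁ (proj₂ in-slot)) (proj₂ (proj₂ in-slot)))
        where in-slot = slot S k p ys 0<p small fits
      place-present S ((k , p) ∷ ys) ((0<p , _) ∷ small) fits i k′ (there present) =
        place-present (advance S (k , p)) ys small (fits-advance S (k , p) ys (QP.<⇒≤ 0<p) fits) i k′ present

      smallJobs : All Small smalls
      smallJobs = All.zip (AllP.filter⁺ (small? I ε) 0<jobs , AllP.all-filter (small? I ε) (jobs I))

      fits₀ : Fits (λ _ → 0ℚ) smalls
      fits₀ k = QP.≤-refl , subst (_≤ total k) (sym (QP.+-identityˡ _)) (smalls≤total k)

      smallPart : List Entry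
      smallPart = place (λ _ → 0ℚ) smalls smallJobs fits₀

      smallPart≤ : ∀ i k → work smallPart i k ≤ capacity k i + δ k
      smallPart≤ i k = QP.≤-trans (place-work (λ _ → 0ℚ) smalls smallJobs fits₀ i k)
        (slack-0 (offset-nonNeg (m I) (0≤capacity k) i) (0≤capacity k i) (QP.<⇒≤ (0<δ k)))

      private
        merged = interleave-filter (small? I ε) (jobs I) smallPart largePart
                   (map-proj₂-place (λ _ → 0ℚ) smalls smallJobs fits₀) map-proj₂-largePart

      L₁ : List Entry
      L₁ = proj₁ merged

      absorbed : Absorbed ε (setup I) L₂ L₁
      absorbed = record { present-⊆ = present-⊆ ; work-≤ = work-≤ }
        where
        present-⊆ : ∀ i k → Present L₁ i k → Present L₂ i k
        present-⊆ i k present = subst (λ L → Present L i k) (sym L₂≡)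
          ([ (λ inSmall → AnyP.++⁺ʳ largePart (work≢0⇒present newPart i k
                            (0<⇒≢0 (place-present (λ _ → 0ℚ) smalls smallJobs fits₀ i k inSmall))))
           , AnyP.++⁺ˡ ]′ (present-interleaving (proj₂ (proj₂ merged)) present))
        work-≤ : ∀ i k → work L₁ i k ≤ work L₂ i k + δ k
        work-≤ i k = begin
          work L₁ i k                                        ≡⟨ work-interleaving (proj₂ (proj₂ merged)) i k ⟩
          work smallPart i k + work largePart i k            ≤⟨ QP.+-monoˡ-≤ (work largePart i k) (smallPart≤ i k) ⟩
          capacity k i + δ k + work largePart i k            ≡⟨ rearrange (capacity k i) (δ k) (work largePart i k) ⟩
          work largePart i k + work newPart i k + δ k        ≡⟨ cong (_+ δ k) (work-++ largePart newPart i k) ⟨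
          work (largePart ++ newPart) i k + δ k              ≡⟨ cong (λ L → work L i k + δ k) L₂≡ ⟨
          work L₂ i k + δ k                                  ∎
          where
          open QP.≤-Reasoning
          rearrange : ∀ x y z → x + y + z ≡ z + x + y
          rearrange x y z = trans (xy∙z≈z∙xy x y z) (sym (QP.+-assoc z x y))

      absorbingSchedule : ∃ λ σ₁ → Absorbed ε (setup I) L₂ (assignment I σ₁)
      absorbingSchedule = proj₁ onto , subst (Absorbed ε (setup I) L₂) (sym (proj₂ onto)) absorbed
        where onto = assign-onto (jobs I) L₁ (proj₁ (proj₂ merged))

    loads-grow : ∀ {xs L′ T} σ → All ((0ℚ <_) ∘ proj₂) xs → Absorbed ε (setup I) (assign xs σ) L′ →
      LoadsAtMost (setup I) (speed I) (assign xs σ) T → LoadsAtMost (setup I) (speed I) L′ ((1ℚ + ε) * T)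
    loads-grow {xs} σ 0<xs = loads-absorbed (QP.<⇒≤ 0<ε) (QP.<⇒≤ ∘ proj₁ (proj₂ positive)) (proj₁ positive)
                            (All.map QP.<⇒≤ (assign-pos xs σ 0<xs))

    toRounded : ∀ {T} → (∃ λ σ → MakespanAtMost I σ T) → ∃ λ σ₂ → MakespanAtMost (I₂ I ε) σ₂ ((1ℚ + ε) * T)
    toRounded (σ , σ≤T) =
      let σ₂ , absorbed = ToRounded.absorbingSchedule σ
      in  σ₂ , loads⇒makespan (I₂ I ε) σ₂ (loads-grow σ 0<jobs absorbed (makespan⇒loads I σ σ≤T))

    fromRounded : ∀ {T} → (∃ λ σ₂ → MakespanAtMost (I₂ I ε) σ₂ T) → ∃ λ σ → MakespanAtMost I σ ((1ℚ + ε) * T)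
    fromRounded (σ₂ , σ₂≤T) =
      let σ , absorbed = FromRounded.absorbingSchedule σ₂
      in  σ , loads⇒makespan I σ (loads-grow σ₂ 0<jobs₂ absorbed (makespan⇒loads (I₂ I ε) σ₂ σ₂≤T))

  εN≡1⇒0<ε : ∀ ε N → ε * (ℤ.+ N Q./ 1) ≡ 1ℚ → 0ℚ < ε
  εN≡1⇒0<ε ε N εN≡1 = QP.≰⇒> λ ε≤0 →
    QP.<-irrefl refl (QP.<-≤-trans (QP.positive⁻¹ 1ℚ) (subst₂ _≤_ εN≡1 (QP.*-zeroˡ n) (*-monoʳ-≤-0≤ n 0≤n ε≤0)))
    where
    n = ℤ.+ N Q./ 1
    0≤n = QP.nonNegative⁻¹ n {{QP.normalize-nonNeg N 1}}

open import Data.Nat using (ℕ; _≤_)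
open import Data.Rational using (ℚ; 1ℚ; _+_; _*_; _/_)
open import Data.Integer using (+_)
open import Data.Product using (_×_; ∃; _,_)
open import Relation.Binary.PropositionalEquality using (_≡_)
open SmallJobRounding using (module Rounding; εN≡1⇒0<ε)

mainTheorem3 : (ε : ℚ) (N : ℕ) → 2 ≤ N → ε * (+ N / 1) ≡ 1ℚ →
    (I : Instance) → PositiveInstance I → (T : ℚ) →
    ((∃ λ (σ : Schedule I) → MakespanAtMost I σ T) →
       ∃ λ (σ : Schedule (I₂ I ε)) → MakespanAtMost (I₂ I ε) σ ((1ℚ + ε) * T))
    × ((∃ λ (σ : Schedule (I₂ I ε)) → MakespanAtMost (I₂ I ε) σ T) →
       ∃ λ (σ : Schedule I) → MakespanAtMost I σ ((1ℚ + ε) * T))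
mainTheorem3 ε N _ εN≡1 I positive _ = toRounded , fromRounded
  where open Rounding I (εN≡1⇒0<ε ε N εN≡1) positive
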